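{- Let $G$ be a finite graph with maximum degree at most 3. Let $f$ be a partial 2-tone 8-coloring of $G$ and let $v$ be a vertex uncolored by $f$. If $v$ has at least one uncolored neighbor and at least one uncolored second-neighbor, then $f$ can be extended to $v$.
   Context: $d(u,v)$ denotes graph distance; $u,v$ are second-neighbors if $d(u,v)=2$. A partial 2-tone $k$-coloring of $G$ is a function $f:S\to\binom{[k]}{2}$ with $S\subseteq V(G)$ such that $|f(u)\cap f(v)|<d(u,v)$ for all distinct $u,v\in S$ (distances measured in $G$); vertices outside $S$ are uncolored. An extension of $f$ to an uncolored vertex $v$ is a partial 2-tone $k$-coloring of $G$ defined on $S\cup\{v\}$ that agrees with $f$ on $S$. -}

module Defs where

open import Data.Nat using (ℕ; zero; suc; _<_; _≤_)
open import Data.Fin using (Fin; _≟_)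
open import Data.Fin.Subset using (Subset; ∣_∣; _∩_)
open import Data.Bool using (Bool; true; false)
open import Data.Maybe using (Maybe; just; nothing)
open import Data.Vec using (tabulate)
open import Data.Product using (_×_; Σ)
open import Relation.Nullary using (¬_; yes; no)
open import Relation.Binary.PropositionalEquality using (_≡_; _≢_)

record Graph : Set where
  field
    n       : ℕ
    adj     : Fin n → Fin n → Bool
    adj-sym : ∀ u v → adj u v ≡ adj v u
    adj-irr : ∀ v → adj v v ≡ false
open Graph public

N : (G : Graph) → Fin (n G) → Subset (n G)
N G v = tabulate (adj G v)

deg : (G : Graph) → Fin (n G) → ℕ
deg G v = ∣ N G v ∣

MaxDegreeAtMost : Graph → ℕ → Set
MaxDegreeAtMost G Δ = ∀ v → deg G v ≤ Δ

data Walk (G : Graph) : Fin (n G) → Fin (n G) → ℕ → Set where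
  here : ∀ {u} → Walk G u u 0
  step : ∀ {u w v k} → adj G u w ≡ true → Walk G w v k → Walk G u v (suc k)

-- graph distance: d(u,v) = k  (if no walk exists, d(u,v) = ∞ and Dist holds for no k)
Dist : (G : Graph) → Fin (n G) → Fin (n G) → ℕ → Set
Dist G u v k = Walk G u v k × (∀ j → j < k → ¬ Walk G u v j)

-- colours: subsets of [k] = Fin k; a 2-tone colour is a 2-element subset
-- A partial colouring assigns Maybe a colour to each vertex (nothing = uncoloured).
PartialAssignment : Graph → ℕ → Set
PartialAssignment G k = Fin (n G) → Maybe (Subset k)

IsPartial2ToneColoring : (G : Graph) (k : ℕ) → PartialAssignment G k → Set
IsPartial2ToneColoring G k f =
  (∀ u c → f u ≡ just c → ∣ c ∣ ≡ 2) ×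
  (∀ u v c d → u ≢ v → f u ≡ just c → f v ≡ just d →
     ∀ m → Dist G u v m → ∣ c ∩ d ∣ < m)

assign : {G : Graph} {k : ℕ} → PartialAssignment G k → Fin (n G) → Subset k →
         PartialAssignment G k
assign f v c w with w ≟ v
... | yes _ = just c
... | no  _ = f w

ExtendsTo : (G : Graph) (k : ℕ) → PartialAssignment G k → Fin (n G) → Set
ExtendsTo G k f v = Σ (Subset k) λ c → IsPartial2ToneColoring G k (assign {G} {k} f v c)

Fin' : Graph → Set
Fin' G = Fin (n G)

-- A colour c for v only has to be checked against vertices at distance at
-- most 2 from v, since |c ∩ d| ≤ |c| = 2 < d(v,x) otherwise.  Hence c works
-- as soon as (i) c is disjoint from S, the union of the colours of the
-- neighbours of v, and (ii) c shares at most one element with the colour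
-- of every second-neighbour of v.  Since v has at most 3 neighbours,
-- one of them uncoloured, |S| ≤ 4; and listing the vertices reached by
-- walks v-y-z with z ≠ v (at most 3·2 = 6 of them, w among them) gives at
-- most 5 colours D to avoid in the sense of (ii).
module Submission where

open import Defs
open import Level using (0ℓ)
open import Data.Nat using (ℕ; zero; suc; _≤_; _<_; _+_; _*_; z≤n; s≤s; _≤?_; _<?_)
open import Data.Nat.Properties
  using (_≟_; ≤-refl; ≤-trans; ≤-reflexive; ≤-pred; ≮⇒≥; m≤n⇒m≤1+n; n≤1+n; m≤m+n; n≤0⇒n≡0;
         +-suc; +-assoc; +-mono-≤; +-monoʳ-≤; +-cancelʳ-≤; *-suc; *-monoʳ-≤; module ≤-Reasoning)
open import Data.Bool using (Bool; true; false; if_then_else_)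
open import Data.Maybe using (Maybe; just; nothing)
open import Data.Fin using (Fin) renaming (zero to fzero; suc to fsuc; _≟_ to _≟ᶠ_)
open import Data.Fin.Subset using (Subset; ∣_∣; _∩_; _∪_; ⋃; _⊆_; inside; outside)
open import Data.Fin.Subset.Properties
  using (∣p∩q∣≤∣p∣; ∩-comm; p⊆q⇒∣p∣≤∣q∣; p⊆p∪q; q⊆p∪q; x∈p∩q⁺; x∈p∩q⁻; ∣⊥∣≡0; anySubset?)
open import Data.Vec using ([]; _∷_; tabulate)
open import Data.List using (List; []; _∷_; _++_; [_]; map; filter; length; concatMap; mapMaybe)
open import Data.List.Properties using (length-map; length-++; length-mapMaybe; filter-notAll)
open import Data.List.Membership.Propositional using (_∈_; lose)
open import Data.List.Membership.Propositional.Properties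
  using (∈-map⁺; ∈-map⁻; ∈-filter⁺; ∈-filter⁻; ∈-concatMap⁺)
open import Data.List.Relation.Unary.All as All using (All; []; _∷_; all?)
open import Data.List.Relation.Unary.Any using (here; there)
open import Data.Product using (Σ; ∃; _×_; _,_; proj₁; proj₂)
open import Data.Sum using (_⊎_; inj₁; inj₂; [_,_]′)
open import Data.Empty using (⊥-elim)
open import Function using (_∘_; flip)
open import Relation.Nullary using (¬_; Dec; yes; no; ¬?; _×-dec_; _→-dec_; contradiction)
open import Relation.Nullary.Decidable using (from-no; decidable-stable)
open import Relation.Unary using (Pred; Decidable)
open import Relation.Binary.PropositionalEquality using (_≡_; refl; sym; trans; cong; subst)

module _ {G : Graph} where

  snoc : ∀ {u w x k} → Walk G u w k → adj G w x ≡ true → Walk G u x (suc k)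
  snoc here       a = step a here
  snoc (step b p) a = step b (snoc p a)

  reverse : ∀ {u x k} → Walk G u x k → Walk G x u k
  reverse here               = here
  reverse (step {u} {w} b p) = snoc (reverse p) (trans (adj-sym G w u) b)

  Dist-sym : ∀ {u x m} → Dist G u x m → Dist G x u m
  Dist-sym (p , shortest) = reverse p , λ j j<m q → shortest j j<m (reverse q)

  Dist-two : ∀ {v x} → Dist G v x 2 →
             Σ (Fin (n G)) λ y → adj G v y ≡ true × adj G y x ≡ true × ¬ x ≡ v
  Dist-two (step a₁ (step a₂ here) , shortest) =
    _ , a₁ , a₂ , λ { refl → shortest 0 (s≤s z≤n) here }

module _ (G : Graph) {k : ℕ} (f : PartialAssignment G k) where

  Compatible : Fin' G → Subset k → Set
  Compatible v c = ∀ x d → ¬ x ≡ v → f x ≡ just d → ∀ m → Dist G v x m → ∣ c ∩ d ∣ < m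

  extend : IsPartial2ToneColoring G k f → ∀ v c → ∣ c ∣ ≡ 2 → Compatible v c →
           IsPartial2ToneColoring G k (assign {G} {k} f v c)
  extend (sizes , separated) v c ∣c∣≡2 compatible = sizes′ , separated′
    where
    sizes′ : ∀ x d → assign {G} {k} f v c x ≡ just d → ∣ d ∣ ≡ 2
    sizes′ x d e with x ≟ᶠ v
    sizes′ x d refl | yes _ = ∣c∣≡2
    ...             | no  _ = sizes x d e

    separated′ : ∀ a b da db → ¬ a ≡ b →
                 assign {G} {k} f v c a ≡ just da → assign {G} {k} f v c b ≡ just db →
                 ∀ m → Dist G a b m → ∣ da ∩ db ∣ < m
    separated′ a b da db a≢b ea eb m dist with a ≟ᶠ v | b ≟ᶠ v
    ... | yes refl | yes refl = ⊥-elim (a≢b refl)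
    separated′ a b da db a≢b refl eb m dist | yes refl | no b≢v =
      compatible b db b≢v eb m dist
    separated′ a b da db a≢b ea refl m dist | no a≢v | yes refl =
      subst (_< m) (cong ∣_∣ (∩-comm c da)) (compatible a da a≢v ea m (Dist-sym dist))
    ... | no _ | no _ = separated a b da db a≢b ea eb m dist

  compatible-local : ∀ v c → ∣ c ∣ ≡ 2 →
    (∀ x d → adj G v x ≡ true → f x ≡ just d → ∣ c ∩ d ∣ ≡ 0) →
    (∀ x d → Dist G v x 2 → f x ≡ just d → ∣ c ∩ d ∣ < 2) →
    Compatible v c
  compatible-local v c ∣c∣≡2 near second x d x≢v fx zero (here , _) = ⊥-elim (x≢v refl)
  compatible-local v c ∣c∣≡2 near second x d x≢v fx 1 (step a here , _) =
    subst (_< 1) (sym (near x d a fx)) (s≤s z≤n)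
  compatible-local v c ∣c∣≡2 near second x d x≢v fx 2 dist = second x d dist fx
  compatible-local v c ∣c∣≡2 near second x d x≢v fx (suc (suc (suc m))) dist =
    s≤s (≤-trans (subst (∣ c ∩ d ∣ ≤_) ∣c∣≡2 (∣p∩q∣≤∣p∣ c d)) (m≤m+n 2 m))

module _ {A : Set} {P Q R : Pred A 0ℓ} (P? : Decidable P) (Q? : Decidable Q) (R? : Decidable R) where

  length-filter-cover : (∀ {x} → P x → Q x ⊎ R x) → ∀ xs →
    length (filter P? xs) ≤ length (filter Q? xs) + length (filter R? xs)
  length-filter-cover cover [] = z≤n
  length-filter-cover cover (x ∷ xs) with ih ← length-filter-cover cover xs | P? x | Q? x | R? x
  ... | yes _  | yes _  | yes _  = s≤s (≤-trans ih (+-monoʳ-≤ _ (n≤1+n _)))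
  ... | yes _  | yes _  | no _   = s≤s ih
  ... | yes _  | no _   | yes _  = ≤-trans (s≤s ih) (≤-reflexive (sym (+-suc _ _)))
  ... | yes px | no ¬qx | no ¬rx = [ flip contradiction ¬qx , flip contradiction ¬rx ]′ (cover px)
  ... | no _   | yes _  | yes _  = m≤n⇒m≤1+n (≤-trans ih (+-monoʳ-≤ _ (n≤1+n _)))
  ... | no _   | yes _  | no _   = m≤n⇒m≤1+n ih
  ... | no _   | no _   | yes _  = ≤-trans ih (+-monoʳ-≤ _ (n≤1+n _))
  ... | no _   | no _   | no _   = ih

filter-witness : {A : Set} {P : Pred A 0ℓ} (P? : Decidable P) (xs : List A) →
                 0 < length (filter P? xs) → ∃ λ x → x ∈ xs × P x
filter-witness P? xs nonempty with filter P? xs in eq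
... | x ∷ _ = x , ∈-filter⁻ P? {xs = xs} (subst (x ∈_) (sym eq) (here refl))

module _ {k : ℕ} where

  Admissible : Subset k → List (Subset k) → Subset k → Set
  Admissible S Ds c = ∣ c ∩ S ∣ ≡ 0 × All (λ D → ∣ c ∩ D ∣ < 2) Ds

  admissible? : ∀ S Ds → Decidable (Admissible S Ds)
  admissible? S Ds c = (∣ c ∩ S ∣ ≟ 0) ×-dec all? (λ D → ∣ c ∩ D ∣ <? 2) Ds

  Clash : Subset k → Subset k → Set
  Clash D c = 2 ≤ ∣ c ∩ D ∣

  clash? : ∀ D → Decidable (Clash D)
  clash? D c = 2 ≤? ∣ c ∩ D ∣

  clashes : Subset k → List (Subset k) → List (Subset k)
  clashes D = filter (clash? D)

  -- each further D removes at most its clashes from the admissible candidates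
  admissible-survivors : ∀ S (cands : List (Subset k)) Ds →
    All (λ D → length (clashes D cands) ≤ 1) Ds →
    length (filter (admissible? S []) cands) ≤ length (filter (admissible? S Ds) cands) + length Ds
  admissible-survivors S cands []       []       = m≤m+n _ 0
  admissible-survivors S cands (D ∷ Ds) (h ∷ hs) = begin
    length (filter (admissible? S []) cands)                 ≤⟨ admissible-survivors S cands Ds hs ⟩
    length (filter (admissible? S Ds) cands) + length Ds     ≤⟨ +-mono-≤ split ≤-refl ⟩
    (length (filter (admissible? S (D ∷ Ds)) cands) + 1) + length Ds
                                                             ≡⟨ +-assoc _ 1 (length Ds) ⟩
    length (filter (admissible? S (D ∷ Ds)) cands) + length (D ∷ Ds) ∎
    where
    open ≤-Reasoning
    split : length (filter (admissible? S Ds) cands) ≤ length (filter (admissible? S (D ∷ Ds)) cands) + 1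
    split = ≤-trans (length-filter-cover {P = Admissible S Ds} {Admissible S (D ∷ Ds)} {Clash D}
                       (admissible? S Ds) (admissible? S (D ∷ Ds)) (clash? D) (λ {c} → cover {c}) cands)
                    (+-monoʳ-≤ _ h)
      where
      cover : ∀ {c} → Admissible S Ds c → Admissible S (D ∷ Ds) c ⊎ Clash D c
      cover {c} (avoidsS , avoidsDs) with ∣ c ∩ D ∣ <? 2
      ... | yes <2 = inj₁ (avoidsS , <2 ∷ avoidsDs)
      ... | no ≮2  = inj₂ (≮⇒≥ ≮2)

-- a universal statement about subsets of [n] follows once an exhaustive
-- search finds no counterexample
everySubset : ∀ {n} {P : Pred (Subset n) 0ℓ} (P? : Decidable P) →
              ¬ ∃ (λ p → ¬ P p) → ∀ p → P p
everySubset P? noCounterexample p = decidable-stable (P? p) (λ ¬Pp → noCounterexample (p , ¬Pp))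

allSubsets : ∀ n → List (Subset n)
allSubsets zero    = [ [] ]
allSubsets (suc n) = map (inside ∷_) (allSubsets n) ++ map (outside ∷_) (allSubsets n)

pairs : List (Subset 8)
pairs = filter (λ c → ∣ c ∣ ≟ 2) (allSubsets 8)

-- removing at most 4 colours leaves the C(4,2) = 6 pairs of 4 remaining colours
pairs-avoiding : ∀ S → ∣ S ∣ ≤ 4 → 6 ≤ length (filter (admissible? S []) pairs)
pairs-avoiding = everySubset P? (from-no (anySubset? (¬? ∘ P?)))
  where
  P? : ∀ S → Dec (∣ S ∣ ≤ 4 → 6 ≤ length (filter (admissible? S []) pairs))
  P? S = (∣ S ∣ ≤? 4) →-dec (6 ≤? length (filter (admissible? S []) pairs))

pairs-clashing : ∀ D → ∣ D ∣ ≤ 2 → length (clashes D pairs) ≤ 1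
pairs-clashing = everySubset P? (from-no (anySubset? (¬? ∘ P?)))
  where
  P? : ∀ D → Dec (∣ D ∣ ≤ 2 → length (clashes D pairs) ≤ 1)
  P? D = (∣ D ∣ ≤? 2) →-dec (length (clashes D pairs) ≤? 1)

freshPair : ∀ S → ∣ S ∣ ≤ 4 → ∀ Ds → All (λ D → ∣ D ∣ ≤ 2) Ds → length Ds ≤ 5 →
            Σ (Subset 8) λ c → ∣ c ∣ ≡ 2 × Admissible S Ds c
freshPair S ∣S∣≤4 Ds small ∣Ds∣≤5 =
  pair-of (filter-witness (admissible? S Ds) pairs survivors-nonempty)
  where
  survivors-nonempty : 0 < length (filter (admissible? S Ds) pairs)
  survivors-nonempty = +-cancelʳ-≤ 5 1 (length (filter (admissible? S Ds) pairs)) (begin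
    6                                                     ≤⟨ pairs-avoiding S ∣S∣≤4 ⟩
    length (filter (admissible? S []) pairs)              ≤⟨ admissible-survivors S pairs Ds
                                                               (All.map (λ {D} → pairs-clashing D) small) ⟩
    length (filter (admissible? S Ds) pairs) + length Ds  ≤⟨ +-monoʳ-≤ _ ∣Ds∣≤5 ⟩
    length (filter (admissible? S Ds) pairs) + 5          ∎)
    where open ≤-Reasoning

  pair-of : (∃ λ c → c ∈ pairs × Admissible S Ds c) → Σ (Subset 8) λ c → ∣ c ∣ ≡ 2 × Admissible S Ds c
  pair-of (c , c∈pairs , admissible) =
    c , proj₂ (∈-filter⁻ (λ c → ∣ c ∣ ≟ 2) {xs = allSubsets 8} c∈pairs) , admissible

∣p∪q∣≤∣p∣+∣q∣ : ∀ {n} (p q : Subset n) → ∣ p ∪ q ∣ ≤ ∣ p ∣ + ∣ q ∣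
∣p∪q∣≤∣p∣+∣q∣ []          []          = z≤n
∣p∪q∣≤∣p∣+∣q∣ (true ∷ p)  (true ∷ q)  = s≤s (≤-trans (∣p∪q∣≤∣p∣+∣q∣ p q) (≤-trans (n≤1+n _) (≤-reflexive (sym (+-suc _ _)))))
∣p∪q∣≤∣p∣+∣q∣ (true ∷ p)  (false ∷ q) = s≤s (∣p∪q∣≤∣p∣+∣q∣ p q)
∣p∪q∣≤∣p∣+∣q∣ (false ∷ p) (true ∷ q)  = ≤-trans (s≤s (∣p∪q∣≤∣p∣+∣q∣ p q)) (≤-reflexive (sym (+-suc _ _)))
∣p∪q∣≤∣p∣+∣q∣ (false ∷ p) (false ∷ q) = ∣p∪q∣≤∣p∣+∣q∣ p q

∣⋃∣≤2*length : ∀ {n} (ps : List (Subset n)) → All (λ p → ∣ p ∣ ≤ 2) ps → ∣ ⋃ ps ∣ ≤ 2 * length ps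
∣⋃∣≤2*length {n} []       []       = ≤-reflexive (∣⊥∣≡0 n)
∣⋃∣≤2*length     (p ∷ ps) (h ∷ hs) = begin
  ∣ p ∪ ⋃ ps ∣           ≤⟨ ∣p∪q∣≤∣p∣+∣q∣ p (⋃ ps) ⟩
  ∣ p ∣ + ∣ ⋃ ps ∣       ≤⟨ +-mono-≤ h (∣⋃∣≤2*length ps hs) ⟩
  2 + 2 * length ps     ≡⟨ sym (*-suc 2 (length ps)) ⟩
  2 * length (p ∷ ps)   ∎
  where open ≤-Reasoning

p⊆⋃ : ∀ {n} {p : Subset n} {ps} → p ∈ ps → p ⊆ ⋃ ps
p⊆⋃ {ps = p ∷ ps} (here refl) = p⊆p∪q (⋃ ps)
p⊆⋃ {ps = q ∷ ps} (there p∈ps) = q⊆p∪q q (⋃ ps) ∘ p⊆⋃ p∈ps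

disjoint-⋃ : ∀ {n} (c : Subset n) {p ps} → p ∈ ps → ∣ c ∩ ⋃ ps ∣ ≡ 0 → ∣ c ∩ p ∣ ≡ 0
disjoint-⋃ c {p} {ps} p∈ps empty = n≤0⇒n≡0 (subst (∣ c ∩ p ∣ ≤_) empty (p⊆q⇒∣p∣≤∣q∣ c∩p⊆c∩⋃))
  where
  c∩p⊆c∩⋃ : c ∩ p ⊆ c ∩ ⋃ ps
  c∩p⊆c∩⋃ x∈c∩p with x∈p∩q⁻ c p x∈c∩p
  ... | x∈c , x∈p = x∈p∩q⁺ (x∈c , p⊆⋃ p∈ps x∈p)

members : ∀ {n} → (Fin n → Bool) → List (Fin n)
members {zero}  p = []
members {suc n} p = if p fzero then fzero ∷ rest else rest
  where rest = map fsuc (members (p ∘ fsuc))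

length-members : ∀ {n} (p : Fin n → Bool) → length (members p) ≡ ∣ tabulate p ∣
length-members {zero}  p = refl
length-members {suc n} p with p fzero
... | true  = cong suc (trans (length-map fsuc (members (p ∘ fsuc))) (length-members (p ∘ fsuc)))
... | false = trans (length-map fsuc (members (p ∘ fsuc))) (length-members (p ∘ fsuc))

∈-members⁺ : ∀ {n} (p : Fin n → Bool) {x} → p x ≡ true → x ∈ members p
∈-members⁺ {suc n} p {fzero} px rewrite px = here refl
∈-members⁺ {suc n} p {fsuc x} px with p fzero
... | true  = there (∈-map⁺ fsuc (∈-members⁺ (p ∘ fsuc) px))
... | false = ∈-map⁺ fsuc (∈-members⁺ (p ∘ fsuc) px)

∈-members⁻ : ∀ {n} (p : Fin n → Bool) {x} → x ∈ members p → p x ≡ true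
∈-members⁻ {suc n} p x∈ with p fzero in eq
∈-members⁻ {suc n} p (here refl) | true = eq
∈-members⁻ {suc n} p (there x∈) | true with ∈-map⁻ fsuc x∈
... | y , y∈ , refl = ∈-members⁻ (p ∘ fsuc) y∈
∈-members⁻ {suc n} p x∈ | false with ∈-map⁻ fsuc x∈
... | y , y∈ , refl = ∈-members⁻ (p ∘ fsuc) y∈

module _ {A B : Set} (f : A → Maybe B) where

  ∈-mapMaybe⁺ : ∀ {x b} xs → x ∈ xs → f x ≡ just b → b ∈ mapMaybe f xs
  ∈-mapMaybe⁺ (x ∷ xs) (here refl) fx rewrite fx = here refl
  ∈-mapMaybe⁺ (y ∷ xs) (there x∈) fx with f y
  ... | just _  = there (∈-mapMaybe⁺ xs x∈ fx)
  ... | nothing = ∈-mapMaybe⁺ xs x∈ fx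

  All-mapMaybe : {P : B → Set} → (∀ x b → f x ≡ just b → P b) → ∀ xs → All P (mapMaybe f xs)
  All-mapMaybe h []       = []
  All-mapMaybe h (x ∷ xs) with f x in eq
  ... | just b  = h x b eq ∷ All-mapMaybe h xs
  ... | nothing = All-mapMaybe h xs

  length-mapMaybe-< : ∀ {x} xs → x ∈ xs → f x ≡ nothing → length (mapMaybe f xs) < length xs
  length-mapMaybe-< (x ∷ xs) (here refl) fx rewrite fx = s≤s (length-mapMaybe f xs)
  length-mapMaybe-< (y ∷ xs) (there x∈) fx with f y
  ... | just _  = s≤s (length-mapMaybe-< xs x∈ fx)
  ... | nothing = m≤n⇒m≤1+n (length-mapMaybe-< xs x∈ fx)

length-concatMap : {A B : Set} (g : A → List B) (xs : List A) →
  (∀ x → x ∈ xs → length (g x) ≤ 2) → length (concatMap g xs) ≤ 2 * length xs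
length-concatMap g []       h = z≤n
length-concatMap g (x ∷ xs) h = begin
  length (g x ++ concatMap g xs)          ≡⟨ length-++ (g x) ⟩
  length (g x) + length (concatMap g xs)  ≤⟨ +-mono-≤ (h x (here refl)) (length-concatMap g xs (λ y → h y ∘ there)) ⟩
  2 + 2 * length xs                       ≡⟨ sym (*-suc 2 (length xs)) ⟩
  2 * length (x ∷ xs)                     ∎
  where open ≤-Reasoning

colour-sizes : ∀ {G k} (f : PartialAssignment G k) → IsPartial2ToneColoring G k f →
               ∀ xs → All (λ d → ∣ d ∣ ≤ 2) (mapMaybe f xs)
colour-sizes f (sizes , _) = All-mapMaybe f (λ x d fx → ≤-reflexive (sizes x d fx))

module NeighbourhoodsOf (G : Graph) (Δ≤3 : MaxDegreeAtMost G 3) where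

  neighbours : Fin' G → List (Fin' G)
  neighbours x = members (adj G x)

  length-neighbours : ∀ x → length (neighbours x) ≤ 3
  length-neighbours x = subst (_≤ 3) (sym (length-members (adj G x))) (Δ≤3 x)

  beyond : Fin' G → Fin' G → List (Fin' G)
  beyond v y = filter (λ z → ¬? (z ≟ᶠ v)) (neighbours y)

  -- if y is a neighbour of v, v itself is one of the at most 3 neighbours of y
  length-beyond : ∀ v y → y ∈ neighbours v → length (beyond v y) ≤ 2
  length-beyond v y y∈ = ≤-pred (≤-trans (filter-notAll (λ z → ¬? (z ≟ᶠ v)) (neighbours y) (lose v∈ (λ v≢v → v≢v refl)))
                                          (length-neighbours y))
    where
    v∈ : v ∈ neighbours y
    v∈ = ∈-members⁺ (adj G y) (trans (adj-sym G y v) (∈-members⁻ (adj G v) y∈))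

  -- the ends z ≠ v of walks v-y-z, listed with repetitions
  secondRing : Fin' G → List (Fin' G)
  secondRing v = concatMap (beyond v) (neighbours v)

  length-secondRing : ∀ v → length (secondRing v) ≤ 6
  length-secondRing v = ≤-trans (length-concatMap (beyond v) (neighbours v) (length-beyond v))
                                (*-monoʳ-≤ 2 (length-neighbours v))

  ∈-secondRing : ∀ {v x} → Dist G v x 2 → x ∈ secondRing v
  ∈-secondRing {v} {x} dist with Dist-two dist
  ... | y , v~y , y~x , x≢v = ∈-concatMap⁺ (beyond v) (lose (∈-members⁺ (adj G v) v~y)
                                                 (∈-filter⁺ (λ z → ¬? (z ≟ᶠ v)) (∈-members⁺ (adj G y) y~x) x≢v))

  module _ {k : ℕ} (f : PartialAssignment G k) where

    nearColours secondColours : Fin' G → List (Subset k)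
    nearColours   v = mapMaybe f (neighbours v)
    secondColours v = mapMaybe f (secondRing v)

    ∈-nearColours : ∀ {v x d} → adj G v x ≡ true → f x ≡ just d → d ∈ nearColours v
    ∈-nearColours {v} v~x = ∈-mapMaybe⁺ f (neighbours v) (∈-members⁺ (adj G v) v~x)

    ∈-secondColours : ∀ {v x d} → Dist G v x 2 → f x ≡ just d → d ∈ secondColours v
    ∈-secondColours {v} v⋯x = ∈-mapMaybe⁺ f (secondRing v) (∈-secondRing v⋯x)

    -- an uncoloured neighbour, resp. second-neighbour, contributes no colour
    length-nearColours : ∀ {v u} → adj G v u ≡ true → f u ≡ nothing → length (nearColours v) ≤ 2
    length-nearColours {v} v~u fu =
      ≤-pred (≤-trans (length-mapMaybe-< f (neighbours v) (∈-members⁺ (adj G v) v~u) fu) (length-neighbours v))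

    length-secondColours : ∀ {v w} → Dist G v w 2 → f w ≡ nothing → length (secondColours v) ≤ 5
    length-secondColours {v} v⋯w fw =
      ≤-pred (≤-trans (length-mapMaybe-< f (secondRing v) (∈-secondRing v⋯w) fw) (length-secondRing v))

mainTheorem6 : (G : Graph) → MaxDegreeAtMost G 3 →
    (f : PartialAssignment G 8) → IsPartial2ToneColoring G 8 f →
    (v : Fin' G) → f v ≡ nothing →
    Σ (Fin' G) (λ u → (adj G v u ≡ true) × (f u ≡ nothing)) →
    Σ (Fin' G) (λ w → Dist G v w 2 × (f w ≡ nothing)) →
    ExtendsTo G 8 f v
mainTheorem6 G Δ≤3 f f-ok v _ (u , v~u , fu) (w , v⋯w , fw) =
  let c , ∣c∣≡2 , avoidsNear , avoidsSecond =
        freshPair (⋃ (nearColours f v)) ∣⋃nearColours∣≤4 (secondColours f v)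
                  (colour-sizes f f-ok (secondRing v)) (length-secondColours f v⋯w fw)
  in c , extend G f f-ok v c ∣c∣≡2 (compatible-local G f v c ∣c∣≡2
           (λ x d v~x fx → disjoint-⋃ c (∈-nearColours f v~x fx) avoidsNear)
           (λ x d v⋯x fx → All.lookup avoidsSecond (∈-secondColours f v⋯x fx)))
  where
  open NeighbourhoodsOf G Δ≤3

  -- at most two coloured neighbours, each with two colours
  ∣⋃nearColours∣≤4 : ∣ ⋃ (nearColours f v) ∣ ≤ 4
  ∣⋃nearColours∣≤4 = ≤-trans (∣⋃∣≤2*length (nearColours f v) (colour-sizes f f-ok (neighbours v)))
                             (*-monoʳ-≤ 2 (length-nearColours f v~u fu))
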